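{- For a prime $p$ and an integer $n$ define $f_p(n)=1-\frac1p$ if $p\mid n$ and $f_p(n)=-\frac1p$ if $p\nmid n$; for $m=\prod_j p_j^{\alpha_j}$ define $f_m(n)=\prod_j f_{p_j}(n)^{\alpha_j}$ (so $f_1\equiv1$). Fix a positive integer $r$. Let $a_1,\dots,a_r$ be pairwise coprime positive integers, let $A_i=\prod_{p\mid a_i}p$ be the square-free part of $a_i$, and let $b_1,\dots,b_r$ be nonnegative integers. Then $$\frac1x\sum_{n\le x}\prod_{i=1}^{r}f_{a_i}(n+b_i)=\prod_{i=1}^{r}\prod_{p^{\alpha}\parallel a_i}\Big(\frac1p\Big(1-\frac1p\Big)^{\alpha}+\Big(\frac{ -1}{p}\Big)^{\alpha}\Big(1-\frac1p\Big)\Big)+O\Big(\frac1x\prod_{i=1}^{r}\tau(A_i)^2\Big),$$ where $\tau$ is the divisor function. In particular the main term is zero unless every $a_i$ is square-full (i.e. $p\mid a_i$ implies $p^2\mid a_i$).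
   Context: $p^\alpha\parallel a$ means $p^\alpha\mid a$ and $p^{\alpha+1}\nmid a$. The implied constant may depend on $r$.
   Formalization: The variable x in the average ranges over the positive rationals. -}

module Defs where

open import Data.Nat as ℕ using (ℕ; zero; suc; _∸_)
open import Data.Nat.Divisibility using (_∣_; _∣?_)
open import Data.Nat.DivMod using (_/_)
open import Data.Nat.Primality using (Prime; prime?)
open import Data.Integer as ℤ using (ℤ; +_)
open import Data.Rational as ℚ using (ℚ; 0ℚ; 1ℚ; _+_; _*_; _-_; -_)
open import Data.Fin using (Fin; toℕ)
open import Data.Product using (_×_)
open import Relation.Nullary using (yes; no)
open import Relation.Nullary.Decidable using (_×-dec_)

_^ℚ_ : ℚ → ℕ → ℚ
q ^ℚ zero  = 1ℚ
q ^ℚ suc k = q * (q ^ℚ k)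

prodQ : ℕ → (ℕ → ℚ) → ℚ
prodQ zero    g = 1ℚ
prodQ (suc n) g = prodQ n g * g n

sumQ : ℕ → (ℕ → ℚ) → ℚ
sumQ zero    g = 0ℚ
sumQ (suc n) g = sumQ n g + g n

prodFin : (r : ℕ) → (Fin r → ℚ) → ℚ
prodFin zero    g = 1ℚ
prodFin (suc r) g = g Fin.zero * prodFin r (λ i → g (Fin.suc i))
  where import Data.Fin as Fin

-- p-adic valuation v_p(m) (exponent α with p^α ∥ m), for p ≥ 2, m ≥ 1;
-- computed by repeated division with fuel m.
valFuel : ℕ → ℕ → ℕ → ℕ
valFuel zero     p m = 0
valFuel (suc fu) zero m = 0
valFuel (suc fu) (suc zero) m = 0
valFuel (suc fu) (suc (suc q)) zero = 0
valFuel (suc fu) (suc (suc q)) (suc m) with suc (suc q) ∣? suc m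
... | yes _ = suc (valFuel fu (suc (suc q)) (suc m / suc (suc q)))
... | no  _ = 0

val : ℕ → ℕ → ℕ
val p m = valFuel m p m

-- ∏_{p^α ∥ m} g p α  : product over the primes p dividing m (p = suc k, k < m)
primeProd : ℕ → (ℕ → ℕ → ℚ) → ℚ
primeProd m g = prodQ m h
  where
  h : ℕ → ℚ
  h k with prime? (suc k) ×-dec (suc k ∣? m)
  ... | yes _ = g (suc k) (val (suc k) m)
  ... | no  _ = 1ℚ

inv : ℕ → ℚ
inv zero    = 0ℚ
inv (suc k) = + 1 ℚ./ suc k

fPrime : ℕ → ℕ → ℚ
fPrime p n with p ∣? n
... | yes _ = 1ℚ - inv p
... | no  _ = - inv p

f : ℕ → ℕ → ℚ
f m n = primeProd m (λ p α → fPrime p n ^ℚ α)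

localFactor : ℕ → ℕ → ℚ
localFactor p α = inv p * ((1ℚ - inv p) ^ℚ α) + ((- inv p) ^ℚ α) * (1ℚ - inv p)

mainFactor : ℕ → ℚ
mainFactor a = primeProd a localFactor

radical : ℕ → ℕ
radical m = go m
  where
  go : ℕ → ℕ
  go zero = 1
  go (suc k) with prime? (suc k) ×-dec (suc k ∣? m)
  ... | yes _ = go k ℕ.* suc k
  ... | no  _ = go k

τ : ℕ → ℕ
τ n = go n
  where
  go : ℕ → ℕ
  go zero = 0
  go (suc k) with suc k ∣? n
  ... | yes _ = suc (go k)
  ... | no  _ = go k

toℚ : ℕ → ℚ
toℚ n = + n ℚ./ 1

-- Writing u = (-1/p)^α and A = (1 - 1/p)^α, one has f_p(m)^α = u + (A - u)·[p ∣ m]. Multiplying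
-- these out, and merging congruence conditions with coprime moduli by the Chinese remainder
-- theorem, ∏_i f_{a_i}(n + b_i) becomes a finite sum Σ c·[d ∣ n + e] with every d dividing
-- A_1 ⋯ A_r. Since #{n ≤ x : d ∣ n + e} = x/d + O(1), the average over n ≤ x is Σ c/d, which
-- factors into the local factors of the main term, with error O(Σ|c| / x); and Σ|c| is at
-- most 3^ω(A_1 ⋯ A_r) ≤ ∏ τ(A_i)², each prime contributing |u| + |A - u| ≤ 3 while τ(A p) = 2 τ(A).

{-# OPTIONS --safe #-}
module Submission where

open import Defs
open import Data.Nat using (ℕ; zero; suc)
open import Data.Rational using (ℚ; 0ℚ; 1ℚ)
open import Relation.Nullary using (Dec; yes; no; contradiction)
open import Relation.Binary.PropositionalEquality using (_≡_; refl; sym; trans; cong; cong₂; subst; module ≡-Reasoning)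
open import Data.Product using (_×_; _,_; proj₁; proj₂)

if?_then_else_ : {P A : Set} → Dec P → A → A → A
if? yes _ then x else y = x
if? no _ then x else y = y

indicator : {P : Set} → Dec P → ℕ
indicator d = if? d then 1 else 0

indicatorℚ : {P : Set} → Dec P → ℚ
indicatorℚ d = if? d then 1ℚ else 0ℚ

module DecFold {P : ℕ → Set} (P? : ∀ k → Dec (P k)) {A : Set} (z : A) (s : ℕ → A → A) where

  fold : ℕ → A
  fold zero = z
  fold (suc k) = if? P? k then s k (fold k) else fold k

  module Unique (G : ℕ → A) (W : ∀ k → Dec (P k) → A)
    (G-zero : G 0 ≡ z) (G-suc : ∀ k → G (suc k) ≡ W k (P? k))
    (W-yes : ∀ k p → W k (yes p) ≡ s k (G k)) (W-no : ∀ k p → W k (no p) ≡ G k) where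

    G≗fold : ∀ k → G k ≡ fold k
    W≗fold : ∀ k d → W k d ≡ (if? d then s k (fold k) else fold k)
    G≗fold zero = G-zero
    G≗fold (suc k) = trans (G-suc k) (W≗fold k (P? k))
    W≗fold k (yes p) = trans (W-yes k p) (cong (s k) (G≗fold k))
    W≗fold k (no p) = trans (W-no k p) (G≗fold k)

fold-related : {P : ℕ → Set} (P? : ∀ k → Dec (P k)) {A B : Set} (R : A → B → Set)
  {z : A} {s : ℕ → A → A} {z' : B} {s' : ℕ → B → B} →
  R z z' → (∀ k {x y} → P k → R x y → R (s k x) (s' k y)) →
  ∀ k → R (DecFold.fold P? z s k) (DecFold.fold P? z' s' k)
fold-related P? R R-z R-s zero = R-z
fold-related P? R R-z R-s (suc k) with P? k
... | yes p = R-s k p (fold-related P? R R-z R-s k)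
... | no _ = fold-related P? R R-z R-s k

module Unfolding where
  open import Data.Nat using (_*_)
  open import Data.Nat.Divisibility using (_∣_; _∣?_)
  open import Data.Nat.Primality using (Prime; prime?)
  open import Data.Rational as ℚ using (ℚ; 1ℚ)
  open import Relation.Nullary.Decidable using (_×-dec_)

  PrimeDivisor : ℕ → ℕ → Set
  PrimeDivisor m k = Prime (suc k) × suc k ∣ m

  primeDivisor? : ∀ m k → Dec (PrimeDivisor m k)
  primeDivisor? m k = prime? (suc k) ×-dec (suc k ∣? m)

  foldPrimeDivisors : {A : Set} → ℕ → A → (ℕ → A → A) → ℕ → A
  foldPrimeDivisors m = DecFold.fold (primeDivisor? m)

  radicalUpTo : ℕ → ℕ → ℕ
  radicalUpTo m = foldPrimeDivisors m 1 (λ k x → x * suc k)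

  primeFactor : ℕ → (ℕ → ℕ → ℚ) → ℕ → ℚ
  primeFactor m g k = if? primeDivisor? m k then g (suc k) (val (suc k) m) else 1ℚ

  prodQ-cong : ∀ n {F G : ℕ → ℚ} → (∀ k → F k ≡ G k) → prodQ n F ≡ prodQ n G
  prodQ-cong zero F≗G = refl
  prodQ-cong (suc n) F≗G = cong₂ ℚ._*_ (prodQ-cong n F≗G) (F≗G n)

  module PrimeFactorUnique (m : ℕ) (g : ℕ → ℕ → ℚ) (W : ∀ k → Dec (PrimeDivisor m k) → ℚ)
    (W-yes : ∀ k p → W k (yes p) ≡ g (suc k) (val (suc k) m)) (W-no : ∀ k p → W k (no p) ≡ 1ℚ) where

    W≗ : ∀ k d → W k d ≡ (if? d then g (suc k) (val (suc k) m) else 1ℚ)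
    W≗ k (yes p) = W-yes k p
    W≗ k (no p) = W-no k p

    W≗∧prodQ-W≡ : (∀ k d → W k d ≡ (if? d then g (suc k) (val (suc k) m) else 1ℚ))
                × (∀ n → prodQ n (λ k → W k (primeDivisor? m k)) ≡ prodQ n (primeFactor m g))
    W≗∧prodQ-W≡ = W≗ , λ n → prodQ-cong n (λ k → W≗ k (primeDivisor? m k))

  divisorCountUpTo : ℕ → ℕ → ℕ
  divisorCountUpTo n = DecFold.fold (λ k → suc k ∣? n) 0 (λ _ → suc)

  -- The loops of Defs are local `with`-functions that cannot be named. Instantiating
  -- DecFold.Unique with metavariables, they get solved by unification against a
  -- goal in which the loop is applied to variables: the module argument must be
  -- with-abstracted, which is possible only one step below the top, at m = 2 + k.

  radical-≡ : ∀ m → radical m ≡ radicalUpTo m m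
  radical-≡ m with DecFold.Unique.W≗fold (primeDivisor? m) 1 (λ k x → x * suc k)
                     _ _ refl (λ _ → refl) (λ _ _ → refl) (λ _ _ → refl)
  radical-≡ zero | _ = refl
  radical-≡ (suc zero) | _ = refl
  radical-≡ (suc (suc k)) | W≗fold with primeDivisor? (suc (suc k)) (suc k)
  ... | yes _ with primeDivisor? (suc (suc k)) k
  ...   | d with suc (suc k)
  ...     | m = cong (_* m) (W≗fold k d)
  radical-≡ (suc (suc k)) | W≗fold | no _ with primeDivisor? (suc (suc k)) k
  ...   | d with suc (suc k)
  ...     | m = W≗fold k d

  τ-≡ : ∀ n → τ n ≡ divisorCountUpTo n n
  τ-≡ n with DecFold.Unique.W≗fold (λ k → suc k ∣? n) 0 (λ _ → suc)
               _ _ refl (λ _ → refl) (λ _ _ → refl) (λ _ _ → refl)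
  τ-≡ zero | _ = refl
  τ-≡ (suc zero) | _ = refl
  τ-≡ (suc (suc k)) | W≗fold with suc (suc k) ∣? suc (suc k)
  ... | yes _ with suc k ∣? suc (suc k)
  ...   | d with suc (suc k)
  ...     | n = cong suc (W≗fold k d)
  τ-≡ (suc (suc k)) | W≗fold | no _ with suc k ∣? suc (suc k)
  ...   | d with suc (suc k)
  ...     | n = W≗fold k d

  primeProd-≡ : ∀ m g → primeProd m g ≡ prodQ m (primeFactor m g)
  primeProd-≡ m g with PrimeFactorUnique.W≗∧prodQ-W≡ m g _ (λ _ _ → refl) (λ _ _ → refl)
  primeProd-≡ zero g | _ = refl
  primeProd-≡ (suc zero) g | _ = refl
  primeProd-≡ (suc (suc k)) g | W≗ , prodQ-W≡ with primeDivisor? (suc (suc k)) (suc k)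
  ... | yes _ with primeDivisor? (suc (suc k)) k | g (suc (suc k)) (val (suc (suc k)) (suc (suc k)))
  ...   | d | gₘ with suc (suc k)
  ...     | m = cong (ℚ._* gₘ) (cong₂ ℚ._*_ (prodQ-W≡ k) (W≗ k d))
  primeProd-≡ (suc (suc k)) g | W≗ , prodQ-W≡ | no _ with primeDivisor? (suc (suc k)) k
  ...   | d with suc (suc k)
  ...     | m = cong (ℚ._* 1ℚ) (cong₂ ℚ._*_ (prodQ-W≡ k) (W≗ k d))

module CoprimeLemmas where
  open import Data.Nat using (_*_)
  open import Data.Nat.Properties using (*-comm)
  open import Data.Nat.Divisibility
  open import Data.Nat.Coprimality as Coprime using (Coprime; coprime-divisor)
  open import Data.Nat.Primality using (Prime; prime⇒irreducible)
  open import Data.Sum using (inj₁; inj₂)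
  open import Relation.Nullary using (¬_)

  coprime-∣ˡ : ∀ {d a b} → d ∣ a → Coprime a b → Coprime d b
  coprime-∣ˡ d∣a a⊥b (i∣d , i∣b) = a⊥b (∣-trans i∣d d∣a , i∣b)

  coprime-∣ : ∀ {d d' a b} → d ∣ a → d' ∣ b → Coprime a b → Coprime d d'
  coprime-∣ d∣a d'∣b a⊥b = coprime-∣ˡ d∣a (Coprime.sym (coprime-∣ˡ d'∣b (Coprime.sym a⊥b)))

  coprime-*ˡ : ∀ {a b c} → Coprime a c → Coprime b c → Coprime (a * b) c
  coprime-*ˡ a⊥c b⊥c (i∣ab , i∣c) = b⊥c (coprime-divisor (coprime-∣ˡ i∣c (Coprime.sym a⊥c)) i∣ab , i∣c)

  prime∤⇒coprime : ∀ {p x} → Prime p → ¬ p ∣ x → Coprime p x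
  prime∤⇒coprime p-prime p∤x (i∣p , i∣x) with prime⇒irreducible p-prime i∣p
  ... | inj₁ i≡1 = i≡1
  ... | inj₂ refl = contradiction i∣x p∤x

  coprime-∣⇒*∣ : ∀ {d d' n} → Coprime d d' → d ∣ n → d' ∣ n → d * d' ∣ n
  coprime-∣⇒*∣ {d} {d'} d⊥d' (divides q refl) d'∣n =
    subst (d * d' ∣_) (*-comm d q) (*-monoʳ-∣ d (coprime-divisor (Coprime.sym d⊥d') (subst (d' ∣_) (*-comm q d) d'∣n)))

module ChineseRemainder where
  open import Data.Nat using (_+_; _*_; _∸_; NonZero)
  open import Data.Nat.Properties using (+-comm; +-assoc; *-assoc; *-comm)
  open import Data.Nat.Divisibility using (_∣_; ∣m+n∣m⇒∣n; ∣m∣n⇒∣m+n; m∣m*n; m*n∣⇒m∣; m*n∣⇒n∣)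
  open import Data.Nat.Coprimality using (Coprime)
  open import Data.Nat.GCD using (module Bézout; module GCD)
  open import Data.Nat.Solver using (module +-*-Solver)
  open import Data.Product using (∃)
  open import Function.Bundles using (_⇔_; mk⇔; Equivalence)
  open +-*-Solver
  open CoprimeLemmas using (coprime-∣⇒*∣)

  ∣-+-multiple⁻ : ∀ d m t → d ∣ m + d * t → d ∣ m
  ∣-+-multiple⁻ d m t d∣m+dt = ∣m+n∣m⇒∣n (subst (d ∣_) (+-comm m (d * t)) d∣m+dt) (m∣m*n t)

  ∣-+-multiple⁺ : ∀ d m t → d ∣ m → d ∣ m + d * t
  ∣-+-multiple⁺ d m t d∣m = ∣m∣n⇒∣m+n d∣m (m∣m*n t)

  _≡_[mod_] : ℕ → ℕ → ℕ → Set
  z ≡ e [mod d ] = ∃ λ t → z ≡ e + d * t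

  -- From 1 + y d' = x d: visibly ≡ e mod d, and ≡ e' mod d' because d x = 1 + y d'.
  solution : (d e d' e' x : ℕ) → ℕ
  solution d e d' e' x = e + d * (x * (e' + (d' ∸ 1) * e))

  solution-mod' : ∀ {d d'} e e' x y → .{{NonZero d'}} → 1 + y * d' ≡ x * d →
                  solution d e d' e' x ≡ e' [mod d' ]
  solution-mod' {d} {suc D} e e' x y bézout = e + y * c , (begin
    e + d * (x * c)         ≡⟨ cong (e +_) (trans (sym (*-assoc d x c)) (cong (_* c) (trans (*-comm d x) (sym bézout)))) ⟩
    e + (1 + y * suc D) * c ≡⟨ solve 4 (λ e e' D y → e :+ (con 1 :+ y :* (con 1 :+ D)) :* (e' :+ D :* e)
                                              := e' :+ (con 1 :+ D) :* (e :+ y :* (e' :+ D :* e))) refl e e' D y ⟩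
    e' + suc D * (e + y * c) ∎)
    where
    open ≡-Reasoning
    c = e' + D * e

  crt : (d e d' e' : ℕ) → ℕ
  crt d e d' e' with Bézout.lemma d d'
  ... | Bézout.result _ _ (Bézout.+- x y _) = solution d e d' e' x
  ... | Bézout.result _ _ (Bézout.-+ x y _) = solution d' e' d e y

  crt-mod : ∀ d e d' e' → Coprime d d' → .{{NonZero d}} → .{{NonZero d'}} →
            crt d e d' e' ≡ e [mod d ] × crt d e d' e' ≡ e' [mod d' ]
  crt-mod d e d' e' d⊥d' with Bézout.lemma d d'
  ... | Bézout.result g gcd (Bézout.+- x y eq) =
    (_ , refl) , solution-mod' e e' x y (subst (λ g → g + y * d' ≡ x * d) (d⊥d' (GCD.commonDivisor gcd)) eq)
  ... | Bézout.result g gcd (Bézout.-+ x y eq) =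
    solution-mod' e' e y x (subst (λ g → g + x * d ≡ y * d') (d⊥d' (GCD.commonDivisor gcd)) eq) , (_ , refl)

  ∣-+[mod] : ∀ {d e z} → z ≡ e [mod d ] → ∀ n → d ∣ n + z ⇔ d ∣ n + e
  ∣-+[mod] {d} {e} (t , refl) n = mk⇔
    (λ d∣n+z → ∣-+-multiple⁻ d (n + e) t (subst (d ∣_) (sym (+-assoc n e (d * t))) d∣n+z))
    (λ d∣n+e → subst (d ∣_) (+-assoc n e (d * t)) (∣-+-multiple⁺ d (n + e) t d∣n+e))

  crt-∣⇔ : ∀ d e d' e' → Coprime d d' → .{{NonZero d}} → .{{NonZero d'}} → ∀ n →
           d * d' ∣ n + crt d e d' e' ⇔ (d ∣ n + e × d' ∣ n + e')
  crt-∣⇔ d e d' e' d⊥d' n with crt-mod d e d' e' d⊥d'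
  ... | z≡e , z≡e' = mk⇔
    (λ dd'∣ → to (∣-+[mod] z≡e n) (m*n∣⇒m∣ d d' dd'∣) , to (∣-+[mod] z≡e' n) (m*n∣⇒n∣ d d' dd'∣))
    (λ (d∣ , d'∣) → coprime-∣⇒*∣ d⊥d' (from (∣-+[mod] z≡e n) d∣) (from (∣-+[mod] z≡e' n) d'∣))
    where open Equivalence

module Radical where
  open import Data.Nat using (_≤_; z≤n; s≤s; NonZero; >-nonZero)
  open import Data.Nat.Properties using (*-mono-≤; m≤n⇒m≤1+n; <-irrefl)
  open import Data.Nat.Divisibility using (_∣_; ∣1⇒≡1; ∣⇒≤)
  open import Data.Nat.Coprimality as Coprime using (Coprime)
  open import Data.Nat.Primality using (Prime; euclidsLemma)
  open import Data.Sum using (inj₁; inj₂)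
  open import Relation.Nullary using (¬_)
  open Unfolding
  open CoprimeLemmas

  radicalUpTo-positive : ∀ m k → 1 ≤ radicalUpTo m k
  radicalUpTo-positive m zero = s≤s z≤n
  radicalUpTo-positive m (suc k) with primeDivisor? m k
  ... | yes _ = *-mono-≤ (radicalUpTo-positive m k) (s≤s z≤n)
  ... | no _ = radicalUpTo-positive m k

  radicalUpTo-nonZero : ∀ m k → NonZero (radicalUpTo m k)
  radicalUpTo-nonZero m k = >-nonZero (radicalUpTo-positive m k)

  prime∣radicalUpTo⇒≤ : ∀ m k {q} → Prime q → q ∣ radicalUpTo m k → q ≤ k
  prime∣radicalUpTo⇒≤ m zero q-prime q∣1 with ∣1⇒≡1 q∣1
  ... | refl = contradiction q-prime λ ()
  prime∣radicalUpTo⇒≤ m (suc k) q-prime q∣R with primeDivisor? m k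
  ... | no _ = m≤n⇒m≤1+n (prime∣radicalUpTo⇒≤ m k q-prime q∣R)
  ... | yes _ with euclidsLemma (radicalUpTo m k) (suc k) q-prime q∣R
  ...   | inj₁ q∣R' = m≤n⇒m≤1+n (prime∣radicalUpTo⇒≤ m k q-prime q∣R')
  ...   | inj₂ q∣k+1 = ∣⇒≤ q∣k+1

  radicalUpTo-coprime : ∀ m k {x} → Coprime m x → Coprime (radicalUpTo m k) x
  radicalUpTo-coprime m zero m⊥x (i∣1 , _) = ∣1⇒≡1 i∣1
  radicalUpTo-coprime m (suc k) m⊥x with primeDivisor? m k
  ... | yes (_ , k+1∣m) = coprime-*ˡ (radicalUpTo-coprime m k m⊥x) (coprime-∣ˡ k+1∣m m⊥x)
  ... | no _ = radicalUpTo-coprime m k m⊥x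

  prime∤radicalUpTo : ∀ m k → Prime (suc k) → ¬ suc k ∣ radicalUpTo m k
  prime∤radicalUpTo m k k+1-prime k+1∣R = <-irrefl refl (prime∣radicalUpTo⇒≤ m k k+1-prime k+1∣R)

  radicalUpTo-coprime-next : ∀ m k → Prime (suc k) → Coprime (radicalUpTo m k) (suc k)
  radicalUpTo-coprime-next m k k+1-prime = Coprime.sym (prime∤⇒coprime k+1-prime (prime∤radicalUpTo m k k+1-prime))

module DivisorCount where
  open import Data.Nat using (_+_; _*_; _∸_; _≤_; z≤n)
  open import Data.Nat.Properties
  open import Data.Nat.Divisibility
  open import Data.Nat.Primality using (Prime)
  open import Relation.Nullary using (¬_)
  open import Data.Nat.Solver using (module +-*-Solver)
  open +-*-Solver
  open Unfolding using (divisorCountUpTo; foldPrimeDivisors; radicalUpTo; primeDivisor?)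
  open Radical using (prime∤radicalUpTo)

  sumTo : ℕ → (ℕ → ℕ) → ℕ
  sumTo zero f = 0
  sumTo (suc k) f = sumTo k f + f (suc k)

  sumTo-cong : ∀ k {f g} → (∀ d → f d ≡ g d) → sumTo k f ≡ sumTo k g
  sumTo-cong zero f≗g = refl
  sumTo-cong (suc k) f≗g = cong₂ _+_ (sumTo-cong k f≗g) (f≗g (suc k))

  sumTo-mono-≤ : ∀ k {f g} → (∀ d → f d ≤ g d) → sumTo k f ≤ sumTo k g
  sumTo-mono-≤ zero f≤g = z≤n
  sumTo-mono-≤ (suc k) f≤g = +-mono-≤ (sumTo-mono-≤ k f≤g) (f≤g (suc k))

  sumTo-+-≤ : ∀ j k (f : ℕ → ℕ) → sumTo k f ≤ sumTo (j + k) f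
  sumTo-+-≤ zero k f = ≤-refl
  sumTo-+-≤ (suc j) k f = ≤-trans (sumTo-+-≤ j k f) (m≤m+n _ _)

  sumTo-monoˡ-≤ : ∀ {j k} f → j ≤ k → sumTo j f ≤ sumTo k f
  sumTo-monoˡ-≤ {j} {k} f j≤k = subst (λ i → sumTo j f ≤ sumTo i f) (m∸n+n≡m j≤k) (sumTo-+-≤ (k ∸ j) j f)

  sumTo-+ : ∀ k (f g : ℕ → ℕ) → sumTo k (λ d → f d + g d) ≡ sumTo k f + sumTo k g
  sumTo-+ zero f g = refl
  sumTo-+ (suc k) f g rewrite sumTo-+ k f g = +-assoc-middle (sumTo k f) (sumTo k g) (f (suc k)) (g (suc k))
    where
    +-assoc-middle : ∀ a b c d → a + b + (c + d) ≡ a + c + (b + d)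
    +-assoc-middle = solve 4 (λ a b c d → a :+ b :+ (c :+ d) := a :+ c :+ (b :+ d)) refl

  sumTo-multiples : ∀ R p' (f : ℕ → ℕ) → sumTo R (λ e → f (e * suc p')) ≤ sumTo (R * suc p') (λ d → if? suc p' ∣? d then f d else 0)
  sumTo-multiples zero p' f = z≤n
  sumTo-multiples (suc R) p' f = +-mono-≤ (≤-trans (sumTo-multiples R p' f) (sumTo-+-≤ p' (R * suc p') _)) last
    where
    last : f (suc R * suc p') ≤ (if? suc p' ∣? suc R * suc p' then f (suc R * suc p') else 0)
    last with suc p' ∣? suc R * suc p'
    ... | yes _ = ≤-refl
    ... | no p∤ = contradiction (n∣m*n (suc R)) p∤

  divisorCountUpTo-sumTo : ∀ n k → divisorCountUpTo n k ≡ sumTo k (λ d → indicator (d ∣? n))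
  divisorCountUpTo-sumTo n zero = refl
  divisorCountUpTo-sumTo n (suc k) with suc k ∣? n
  ... | yes _ = trans (cong suc (divisorCountUpTo-sumTo n k)) (+-comm 1 _)
  ... | no _ = trans (divisorCountUpTo-sumTo n k) (sym (+-identityʳ _))

  divisorCount : ℕ → ℕ
  divisorCount n = divisorCountUpTo n n

  -- the divisors d of R and the multiples d p are distinct divisors of R p
  divisorCount-*-prime : ∀ R p → Prime p → ¬ p ∣ R → 2 * divisorCount R ≤ divisorCount (R * p)
  divisorCount-*-prime R (suc p') _ p∤R = begin
    2 * divisorCount R                 ≡⟨ cong (λ t → t + (t + 0)) (divisorCountUpTo-sumTo R R) ⟩
    T + (T + 0)                        ≡⟨ cong (T +_) (+-identityʳ T) ⟩
    T + T                              ≤⟨ +-mono-≤ (sumTo-monoˡ-≤ [∣R] (m≤m*n R p)) multiples ⟩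
    sumTo Rp [∣R] + sumTo Rp [p∣∧∣Rp]  ≡⟨ sym (sumTo-+ Rp [∣R] [p∣∧∣Rp]) ⟩
    sumTo Rp (λ d → [∣R] d + [p∣∧∣Rp] d) ≤⟨ sumTo-mono-≤ Rp pointwise ⟩
    sumTo Rp [∣Rp]                     ≡⟨ sym (divisorCountUpTo-sumTo Rp Rp) ⟩
    divisorCount Rp                    ∎
    where
    open ≤-Reasoning
    p = suc p'
    Rp = R * p
    [∣R] [∣Rp] [p∣∧∣Rp] : ℕ → ℕ
    [∣R] d = indicator (d ∣? R)
    [∣Rp] d = indicator (d ∣? Rp)
    [p∣∧∣Rp] d = if? p ∣? d then [∣Rp] d else 0
    T = sumTo R [∣R]

    [∣Rp]-multiple : ∀ e → [∣Rp] (e * p) ≡ [∣R] e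
    [∣Rp]-multiple e with e * p ∣? Rp | e ∣? R
    ... | yes _ | yes _ = refl
    ... | no _ | no _ = refl
    ... | yes ep∣Rp | no e∤R = contradiction (*-cancelʳ-∣ p ep∣Rp) e∤R
    ... | no ep∤Rp | yes e∣R = contradiction (*-monoˡ-∣ p e∣R) ep∤Rp

    multiples : T ≤ sumTo Rp [p∣∧∣Rp]
    multiples = ≤-trans (≤-reflexive (sym (sumTo-cong R [∣Rp]-multiple))) (sumTo-multiples R p' [∣Rp])

    pointwise : ∀ d → [∣R] d + [p∣∧∣Rp] d ≤ [∣Rp] d
    pointwise d with d ∣? R | d ∣? Rp | p ∣? d
    ... | yes d∣R | no d∤Rp | _ = contradiction (∣m⇒∣m*n p d∣R) d∤Rp
    ... | yes d∣R | yes _ | yes p∣d = contradiction (∣-trans p∣d d∣R) p∤R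
    ... | yes _ | yes _ | no _ = ≤-refl
    ... | no _ | yes _ | yes _ = ≤-refl
    ... | no _ | yes _ | no _ = z≤n
    ... | no _ | no _ | yes _ = ≤-refl
    ... | no _ | no _ | no _ = ≤-refl

  3^ω-upTo : ℕ → ℕ → ℕ
  3^ω-upTo m = foldPrimeDivisors m 1 (λ _ x → 3 * x)

  3^ω-upTo-≤ : ∀ m k → 3^ω-upTo m k ≤ divisorCount (radicalUpTo m k) * divisorCount (radicalUpTo m k)
  3^ω-upTo-≤ m zero = ≤-refl
  3^ω-upTo-≤ m (suc k) with primeDivisor? m k
  ... | no _ = 3^ω-upTo-≤ m k
  ... | yes (k+1-prime , _) = begin
    3 * 3^ω-upTo m k          ≤⟨ *-monoʳ-≤ 3 (3^ω-upTo-≤ m k) ⟩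
    3 * (t * t)               ≤⟨ *-monoˡ-≤ (t * t) (n≤1+n 3) ⟩
    4 * (t * t)               ≡⟨ solve 1 (λ t → con 4 :* (t :* t) := (con 2 :* t) :* (con 2 :* t)) refl t ⟩
    (2 * t) * (2 * t)         ≤⟨ *-mono-≤ doubling doubling ⟩
    divisorCount (R * suc k) * divisorCount (R * suc k) ∎
    where
    open ≤-Reasoning
    R = radicalUpTo m k
    t = divisorCount R
    doubling : 2 * t ≤ divisorCount (R * suc k)
    doubling = divisorCount-*-prime R (suc k) k+1-prime (prime∤radicalUpTo m k k+1-prime)

module RationalLemmas where
  import Data.Nat as ℕ
  import Data.Nat.Properties as ℕ
  open import Data.Integer as ℤ using (+_)
  import Data.Integer.Properties as ℤ
  open import Data.Rational as ℚ using (ℚ; 0ℚ; 1ℚ; _+_; _*_; _-_; -_; ∣_∣; _≤_; toℚᵘ)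
  open import Data.Rational.Properties
  open import Data.Rational.Unnormalised as ℚᵘ using (mkℚᵘ; *≡*)
  import Data.Rational.Unnormalised.Properties as ℚᵘ

  toℚᵘ-toℚ : ∀ n → toℚᵘ (toℚ n) ℚᵘ.≃ mkℚᵘ (+ n) 0
  toℚᵘ-toℚ n = toℚᵘ-fromℚᵘ (mkℚᵘ (+ n) 0)

  toℚᵘ-inv : ∀ k → toℚᵘ (inv (suc k)) ℚᵘ.≃ mkℚᵘ (+ 1) k
  toℚᵘ-inv k = toℚᵘ-fromℚᵘ (mkℚᵘ (+ 1) k)

  toℚ-+ : ∀ m n → toℚ (m ℕ.+ n) ≡ toℚ m + toℚ n
  toℚ-+ m n = toℚᵘ-injective (ℚᵘ.≃-trans (toℚᵘ-toℚ (m ℕ.+ n)) (ℚᵘ.≃-sym (ℚᵘ.≃-trans (toℚᵘ-homo-+ (toℚ m) (toℚ n))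
    (ℚᵘ.≃-trans (ℚᵘ.+-cong (toℚᵘ-toℚ m) (toℚᵘ-toℚ n))
      (*≡* (cong (ℤ._* + 1) (trans (cong₂ ℤ._+_ (ℤ.*-identityʳ (+ m)) (ℤ.*-identityʳ (+ n))) (sym (ℤ.pos-+ m n)))))))))

  toℚ-* : ∀ m n → toℚ (m ℕ.* n) ≡ toℚ m * toℚ n
  toℚ-* m n = toℚᵘ-injective (ℚᵘ.≃-trans (toℚᵘ-toℚ (m ℕ.* n)) (ℚᵘ.≃-sym (ℚᵘ.≃-trans (toℚᵘ-homo-* (toℚ m) (toℚ n))
    (ℚᵘ.≃-trans (ℚᵘ.*-cong (toℚᵘ-toℚ m) (toℚᵘ-toℚ n)) (*≡* (cong (ℤ._* + 1) (sym (ℤ.pos-* m n))))))))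

  toℚ-nonNeg : ∀ n → 0ℚ ≤ toℚ n
  toℚ-nonNeg n = nonNegative⁻¹ (toℚ n) {{normalize-nonNeg n 1}}

  toℚ-mono-≤ : ∀ {m n} → m ℕ.≤ n → toℚ m ≤ toℚ n
  toℚ-mono-≤ {m} {n} m≤n = begin
    toℚ m                  ≡⟨ sym (+-identityʳ (toℚ m)) ⟩
    toℚ m + 0ℚ             ≤⟨ +-monoʳ-≤ (toℚ m) (toℚ-nonNeg (n ℕ.∸ m)) ⟩
    toℚ m + toℚ (n ℕ.∸ m)  ≡⟨ sym (toℚ-+ m (n ℕ.∸ m)) ⟩
    toℚ (m ℕ.+ (n ℕ.∸ m))  ≡⟨ cong toℚ (ℕ.m+[n∸m]≡n m≤n) ⟩
    toℚ n                  ∎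
    where open ≤-Reasoning

  toℚ*inv : ∀ k → toℚ (suc k) * inv (suc k) ≡ 1ℚ
  toℚ*inv k = toℚᵘ-injective (ℚᵘ.≃-trans (toℚᵘ-homo-* (toℚ (suc k)) (inv (suc k)))
    (ℚᵘ.≃-trans (ℚᵘ.*-cong (toℚᵘ-toℚ (suc k)) (toℚᵘ-inv k)) (*≡* (cong (λ n → + suc n) (solve-k k)))))
    where
    solve-k : ∀ k → k ℕ.* 1 ℕ.* 1 ≡ k ℕ.+ 0 ℕ.+ 0
    solve-k k = trans (ℕ.*-identityʳ (k ℕ.* 1)) (trans (ℕ.*-identityʳ k) (sym (trans (ℕ.+-identityʳ (k ℕ.+ 0)) (ℕ.+-identityʳ k))))

  inv-* : ∀ m n → inv (m ℕ.* n) ≡ inv m * inv n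
  inv-* zero n = sym (*-zeroˡ (inv n))
  inv-* (suc m) zero = trans (cong inv (ℕ.*-zeroʳ (suc m))) (sym (*-zeroʳ (inv (suc m))))
  inv-* (suc m) (suc n) = toℚᵘ-injective (ℚᵘ.≃-trans (toℚᵘ-inv (n ℕ.+ m ℕ.* suc n))
    (ℚᵘ.≃-sym (ℚᵘ.≃-trans (toℚᵘ-homo-* (inv (suc m)) (inv (suc n))) (ℚᵘ.≃-trans (ℚᵘ.*-cong (toℚᵘ-inv m) (toℚᵘ-inv n)) (*≡* refl)))))

  inv-nonNeg : ∀ k → 0ℚ ≤ inv k
  inv-nonNeg zero = ≤-refl
  inv-nonNeg (suc k) = nonNegative⁻¹ (inv (suc k)) {{normalize-nonNeg 1 (suc k)}}

  *-mono-≤-nonNeg : ∀ {p q r s} → 0ℚ ≤ p → 0ℚ ≤ r → p ≤ q → r ≤ s → p * r ≤ q * s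
  *-mono-≤-nonNeg {p} {q} {r} {s} 0≤p 0≤r p≤q r≤s =
    ≤-trans (*-monoʳ-≤-nonNeg r {{ℚ.nonNegative 0≤r}} p≤q) (*-monoˡ-≤-nonNeg q {{ℚ.nonNegative (≤-trans 0≤p p≤q)}} r≤s)

  *-nonNeg : ∀ {p q} → 0ℚ ≤ p → 0ℚ ≤ q → 0ℚ ≤ p * q
  *-nonNeg 0≤p 0≤q = *-mono-≤-nonNeg ≤-refl ≤-refl 0≤p 0≤q

  inv≤1 : ∀ k → inv k ≤ 1ℚ
  inv≤1 zero = nonNegative⁻¹ 1ℚ
  inv≤1 (suc k) = begin
    inv (suc k)                ≡⟨ sym (*-identityˡ (inv (suc k))) ⟩
    1ℚ * inv (suc k)           ≤⟨ *-monoʳ-≤-nonNeg (inv (suc k)) {{ℚ.nonNegative (inv-nonNeg (suc k))}} (toℚ-mono-≤ {1} {suc k} (ℕ.s≤s ℕ.z≤n)) ⟩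
    toℚ (suc k) * inv (suc k)  ≡⟨ toℚ*inv k ⟩
    1ℚ                         ∎
    where open ≤-Reasoning

  ∣^ℚ∣≤1 : ∀ q α → ∣ q ∣ ≤ 1ℚ → ∣ q ^ℚ α ∣ ≤ 1ℚ
  ∣^ℚ∣≤1 q zero _ = ≤-refl
  ∣^ℚ∣≤1 q (suc α) ∣q∣≤1 = begin
    ∣ q * (q ^ℚ α) ∣     ≡⟨ ∣p*q∣≡∣p∣*∣q∣ q (q ^ℚ α) ⟩
    ∣ q ∣ * ∣ q ^ℚ α ∣   ≤⟨ *-mono-≤-nonNeg (0≤∣p∣ q) (0≤∣p∣ (q ^ℚ α)) ∣q∣≤1 (∣^ℚ∣≤1 q α ∣q∣≤1) ⟩
    1ℚ * 1ℚ              ≡⟨ *-identityˡ 1ℚ ⟩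
    1ℚ                   ∎
    where open ≤-Reasoning

  ∣-inv∣≤1 : ∀ k → ∣ - inv k ∣ ≤ 1ℚ
  ∣-inv∣≤1 k = ≤-trans (≤-reflexive (trans (∣-p∣≡∣p∣ (inv k)) (0≤p⇒∣p∣≡p (inv-nonNeg k)))) (inv≤1 k)

  ∣1-inv∣≤1 : ∀ k → ∣ 1ℚ - inv k ∣ ≤ 1ℚ
  ∣1-inv∣≤1 k = ≤-trans (≤-reflexive (0≤p⇒∣p∣≡p 0≤1-inv)) 1-inv≤1
    where
    0≤1-inv : 0ℚ ≤ 1ℚ - inv k
    0≤1-inv = ≤-trans (≤-reflexive (sym (+-inverseʳ (inv k)))) (+-monoˡ-≤ (- inv k) (inv≤1 k))
    1-inv≤1 : 1ℚ - inv k ≤ 1ℚ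
    1-inv≤1 = ≤-trans (+-monoʳ-≤ 1ℚ (neg-antimono-≤ (inv-nonNeg k))) (≤-reflexive (+-identityʳ 1ℚ))

module CongruenceSums where
  open import Data.Nat as ℕ using (NonZero)
  open import Data.Nat.Divisibility using (_∣_; _∣?_; *-pres-∣; 0∣⇒≡0)
  open import Data.Nat.Coprimality using (Coprime)
  open import Data.List using (List; []; _∷_; map; _++_)
  open import Data.List.Relation.Unary.All as All using (All; []; _∷_)
  import Data.List.Relation.Unary.All.Properties as All
  open import Data.Rational as ℚ using (ℚ; 0ℚ; _+_; _*_; ∣_∣; _≤_)
  open import Data.Rational.Properties
  open import Data.Rational.Solver using (module +-*-Solver)
  open import Function.Bundles using (Equivalence)
  open +-*-Solver
  open ChineseRemainder using (crt; crt-∣⇔)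
  open CoprimeLemmas using (coprime-∣)
  open RationalLemmas using (inv-*; inv-nonNeg; inv≤1)

  record Term : Set where
    constructor term
    field
      coeff : ℚ
      modulus : ℕ
      shift : ℕ

  CongruenceSum : Set
  CongruenceSum = List Term

  eval : CongruenceSum → ℕ → ℚ
  eval [] n = 0ℚ
  eval (term c d e ∷ L) n = c * indicatorℚ (d ∣? n ℕ.+ e) + eval L n

  mean : CongruenceSum → ℚ
  mean [] = 0ℚ
  mean (term c d e ∷ L) = c * inv d + mean L

  mass : CongruenceSum → ℚ
  mass [] = 0ℚ
  mass (term c d e ∷ L) = ∣ c ∣ + mass L

  ModuliDivide : ℕ → CongruenceSum → Set
  ModuliDivide D = All (λ t → Term.modulus t ∣ D)

  _⊗ₜ_ : Term → Term → Term
  term c d e ⊗ₜ term c' d' e' = term (c * c') (d ℕ.* d') (crt d e d' e')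

  _⊗_ : CongruenceSum → CongruenceSum → CongruenceSum
  [] ⊗ L' = []
  (t ∷ L) ⊗ L' = map (t ⊗ₜ_) L' ++ (L ⊗ L')

  ∣-nonZero : ∀ {d D} → d ∣ D → NonZero D → NonZero d
  ∣-nonZero {zero} d∣D D≢0 = subst NonZero (0∣⇒≡0 d∣D) D≢0
  ∣-nonZero {suc d} _ _ = _

  indicatorℚ-crt : ∀ d e d' e' → Coprime d d' → NonZero d → NonZero d' → ∀ n →
    indicatorℚ (d ℕ.* d' ∣? n ℕ.+ crt d e d' e') ≡ indicatorℚ (d ∣? n ℕ.+ e) * indicatorℚ (d' ∣? n ℕ.+ e')
  indicatorℚ-crt d e d' e' d⊥d' d≢0 d'≢0 n
    with d ℕ.* d' ∣? n ℕ.+ crt d e d' e' | d ∣? n ℕ.+ e | d' ∣? n ℕ.+ e'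
  ... | yes _ | yes _ | yes _ = refl
  ... | yes dd'∣ | no d∤ | _ = contradiction (proj₁ (to dd'∣)) d∤
    where open Equivalence (crt-∣⇔ d e d' e' d⊥d' {{d≢0}} {{d'≢0}} n)
  ... | yes dd'∣ | yes _ | no d'∤ = contradiction (proj₂ (to dd'∣)) d'∤
    where open Equivalence (crt-∣⇔ d e d' e' d⊥d' {{d≢0}} {{d'≢0}} n)
  ... | no dd'∤ | yes d∣ | yes d'∣ = contradiction (from (d∣ , d'∣)) dd'∤
    where open Equivalence (crt-∣⇔ d e d' e' d⊥d' {{d≢0}} {{d'≢0}} n)
  ... | no _ | no _ | d'? = sym (*-zeroˡ (indicatorℚ d'?))
  ... | no _ | yes _ | no _ = refl

  eval-++ : ∀ L L' n → eval (L ++ L') n ≡ eval L n + eval L' n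
  eval-++ [] L' n = sym (+-identityˡ (eval L' n))
  eval-++ (term c d e ∷ L) L' n =
    trans (cong (c * indicatorℚ (d ∣? n ℕ.+ e) +_) (eval-++ L L' n)) (sym (+-assoc (c * indicatorℚ (d ∣? n ℕ.+ e)) (eval L n) (eval L' n)))

  mean-++ : ∀ L L' → mean (L ++ L') ≡ mean L + mean L'
  mean-++ [] L' = sym (+-identityˡ (mean L'))
  mean-++ (term c d e ∷ L) L' = trans (cong (c * inv d +_) (mean-++ L L')) (sym (+-assoc (c * inv d) (mean L) (mean L')))

  mass-++ : ∀ L L' → mass (L ++ L') ≡ mass L + mass L'
  mass-++ [] L' = sym (+-identityˡ (mass L'))
  mass-++ (term c d e ∷ L) L' = trans (cong (∣ c ∣ +_) (mass-++ L L')) (sym (+-assoc ∣ c ∣ (mass L) (mass L')))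

  factor-common : ∀ c c' I I' E → (c * c') * (I * I') + (c * I) * E ≡ (c * I) * (c' * I' + E)
  factor-common = solve 5 (λ c c' I I' E → (c :* c') :* (I :* I') :+ (c :* I) :* E := (c :* I) :* (c' :* I' :+ E)) refl

  mean-map : ∀ c d e L' → mean (map (term c d e ⊗ₜ_) L') ≡ (c * inv d) * mean L'
  mean-map c d e [] = sym (*-zeroʳ (c * inv d))
  mean-map c d e (term c' d' e' ∷ L') = begin
    (c * c') * inv (d ℕ.* d') + mean (map (term c d e ⊗ₜ_) L')
      ≡⟨ cong₂ _+_ (cong ((c * c') *_) (inv-* d d')) (mean-map c d e L') ⟩
    (c * c') * (inv d * inv d') + (c * inv d) * mean L'
      ≡⟨ factor-common c c' (inv d) (inv d') (mean L') ⟩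
    (c * inv d) * (c' * inv d' + mean L') ∎
    where open ≡-Reasoning

  mass-map : ∀ c d e L' → mass (map (term c d e ⊗ₜ_) L') ≡ ∣ c ∣ * mass L'
  mass-map c d e [] = sym (*-zeroʳ ∣ c ∣)
  mass-map c d e (term c' d' e' ∷ L') =
    trans (cong₂ _+_ (∣p*q∣≡∣p∣*∣q∣ c c') (mass-map c d e L')) (sym (*-distribˡ-+ ∣ c ∣ ∣ c' ∣ (mass L')))

  mean-⊗ : ∀ L L' → mean (L ⊗ L') ≡ mean L * mean L'
  mean-⊗ [] L' = sym (*-zeroˡ (mean L'))
  mean-⊗ (term c d e ∷ L) L' = begin
    mean (map (term c d e ⊗ₜ_) L' ++ (L ⊗ L'))        ≡⟨ mean-++ (map (term c d e ⊗ₜ_) L') (L ⊗ L') ⟩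
    mean (map (term c d e ⊗ₜ_) L') + mean (L ⊗ L')    ≡⟨ cong₂ _+_ (mean-map c d e L') (mean-⊗ L L') ⟩
    (c * inv d) * mean L' + mean L * mean L'          ≡⟨ sym (*-distribʳ-+ (mean L') (c * inv d) (mean L)) ⟩
    (c * inv d + mean L) * mean L'                    ∎
    where open ≡-Reasoning

  mass-⊗ : ∀ L L' → mass (L ⊗ L') ≡ mass L * mass L'
  mass-⊗ [] L' = sym (*-zeroˡ (mass L'))
  mass-⊗ (term c d e ∷ L) L' = begin
    mass (map (term c d e ⊗ₜ_) L' ++ (L ⊗ L'))        ≡⟨ mass-++ (map (term c d e ⊗ₜ_) L') (L ⊗ L') ⟩
    mass (map (term c d e ⊗ₜ_) L') + mass (L ⊗ L')    ≡⟨ cong₂ _+_ (mass-map c d e L') (mass-⊗ L L') ⟩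
    ∣ c ∣ * mass L' + mass L * mass L'                ≡⟨ sym (*-distribʳ-+ (mass L') ∣ c ∣ (mass L)) ⟩
    (∣ c ∣ + mass L) * mass L'                        ∎
    where open ≡-Reasoning

  moduliDivide-⊗ : ∀ {D D'} L L' → ModuliDivide D L → ModuliDivide D' L' → ModuliDivide (D ℕ.* D') (L ⊗ L')
  moduliDivide-⊗ [] L' _ _ = []
  moduliDivide-⊗ (term c d e ∷ L) L' (d∣D ∷ L∣D) L'∣D' =
    All.++⁺ (All.map⁺ (All.map (*-pres-∣ d∣D) L'∣D')) (moduliDivide-⊗ L L' L∣D L'∣D')

  module _ {D D'} (D≢0 : NonZero D) (D'≢0 : NonZero D') (D⊥D' : Coprime D D') where

    eval-map : ∀ c d e L' → d ∣ D → ModuliDivide D' L' → ∀ n →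
               eval (map (term c d e ⊗ₜ_) L') n ≡ (c * indicatorℚ (d ∣? n ℕ.+ e)) * eval L' n
    eval-map c d e [] d∣D _ n = sym (*-zeroʳ (c * indicatorℚ (d ∣? n ℕ.+ e)))
    eval-map c d e (term c' d' e' ∷ L') d∣D (d'∣D' ∷ L'∣D') n = begin
      (c * c') * indicatorℚ (d ℕ.* d' ∣? n ℕ.+ crt d e d' e') + eval (map (term c d e ⊗ₜ_) L') n
        ≡⟨ cong₂ _+_ (cong ((c * c') *_) (indicatorℚ-crt d e d' e' (coprime-∣ d∣D d'∣D' D⊥D') (∣-nonZero d∣D D≢0) (∣-nonZero d'∣D' D'≢0) n))
                     (eval-map c d e L' d∣D L'∣D' n) ⟩
      (c * c') * (I * I') + (c * I) * eval L' n
        ≡⟨ factor-common c c' I I' (eval L' n) ⟩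
      (c * I) * (c' * I' + eval L' n) ∎
      where
      open ≡-Reasoning
      I = indicatorℚ (d ∣? n ℕ.+ e)
      I' = indicatorℚ (d' ∣? n ℕ.+ e')

    eval-⊗ : ∀ L L' → ModuliDivide D L → ModuliDivide D' L' → ∀ n → eval (L ⊗ L') n ≡ eval L n * eval L' n
    eval-⊗ [] L' _ _ n = sym (*-zeroˡ (eval L' n))
    eval-⊗ (term c d e ∷ L) L' (d∣D ∷ L∣D) L'∣D' n = begin
      eval (map (term c d e ⊗ₜ_) L' ++ (L ⊗ L')) n      ≡⟨ eval-++ (map (term c d e ⊗ₜ_) L') (L ⊗ L') n ⟩
      eval (map (term c d e ⊗ₜ_) L') n + eval (L ⊗ L') n
        ≡⟨ cong₂ _+_ (eval-map c d e L' d∣D L'∣D' n) (eval-⊗ L L' L∣D L'∣D' n) ⟩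
      (c * I) * eval L' n + eval L n * eval L' n        ≡⟨ sym (*-distribʳ-+ (eval L' n) (c * I) (eval L n)) ⟩
      (c * I + eval L n) * eval L' n                    ∎
      where
      open ≡-Reasoning
      I = indicatorℚ (d ∣? n ℕ.+ e)

  mass-nonNeg : ∀ L → 0ℚ ≤ mass L
  mass-nonNeg [] = ≤-refl
  mass-nonNeg (term c d e ∷ L) = ≤-trans (≤-reflexive (sym (+-identityʳ 0ℚ))) (+-mono-≤ (0≤∣p∣ c) (mass-nonNeg L))

  ∣mean∣≤mass : ∀ L → ∣ mean L ∣ ≤ mass L
  ∣mean∣≤mass [] = ≤-refl
  ∣mean∣≤mass (term c d e ∷ L) = begin
    ∣ c * inv d + mean L ∣
      ≤⟨ ∣p+q∣≤∣p∣+∣q∣ (c * inv d) (mean L) ⟩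
    ∣ c * inv d ∣ + ∣ mean L ∣
      ≡⟨ cong (_+ ∣ mean L ∣) (trans (∣p*q∣≡∣p∣*∣q∣ c (inv d)) (cong (∣ c ∣ *_) (0≤p⇒∣p∣≡p (inv-nonNeg d)))) ⟩
    ∣ c ∣ * inv d + ∣ mean L ∣
      ≤⟨ +-mono-≤ (≤-trans (*-monoˡ-≤-nonNeg ∣ c ∣ {{ℚ.nonNegative (0≤∣p∣ c)}} (inv≤1 d)) (≤-reflexive (*-identityʳ ∣ c ∣)))
                  (∣mean∣≤mass L) ⟩
    ∣ c ∣ + mass L ∎
    where open ≤-Reasoning

module Counting where
  open import Data.Nat as ℕ using (_<_; z≤n; s≤s)
  import Data.Nat.Properties as ℕ
  open import Data.Nat.Divisibility using (_∣?_; _∣_; ∣⇒≤; ∣m+n∣m⇒∣n; n∣m*n; ∣m∣n⇒∣m+n; ∣-refl)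
  open import Data.Nat.DivMod using (_%_; _/_; m≡m%n+[m/n]*n; m%n<n)
  open import Data.Nat.Solver using (module +-*-Solver)
  open import Data.Product using (∃)
  open import Data.Sum using (inj₁; inj₂)
  open +-*-Solver

  countMultiples : (d e N : ℕ) → ℕ
  countMultiples d e zero = 0
  countMultiples d e (suc N) = countMultiples d e N ℕ.+ indicator (d ∣? suc N ℕ.+ e)

  -- ρ is the residue of N + e modulo d
  countMultiples-invariant : ∀ d' e N → ∃ λ ρ → ρ < suc d' ×
    N ℕ.+ e ≡ ρ ℕ.+ (e / suc d' ℕ.+ countMultiples (suc d') e N) ℕ.* suc d'
  countMultiples-invariant d' e zero =
    e % suc d' , m%n<n e (suc d') , trans (m≡m%n+[m/n]*n e (suc d')) (cong (λ q → e % suc d' ℕ.+ q ℕ.* suc d') (sym (ℕ.+-identityʳ (e / suc d'))))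
  countMultiples-invariant d' e (suc N) with countMultiples-invariant d' e N
  ... | ρ , ρ<d , N+e≡ with suc d' ∣? suc N ℕ.+ e | ℕ.m≤n⇒m<n∨m≡n ρ<d
  ...   | yes d∣ | inj₁ ρ+1<d = contradiction (∣⇒≤ d∣ρ+1) (ℕ.<⇒≱ ρ+1<d)
    where
    d∣ρ+1 : suc d' ∣ suc ρ
    d∣ρ+1 = ∣m+n∣m⇒∣n (subst (suc d' ∣_) (trans (cong suc N+e≡) (ℕ.+-comm (suc ρ) _)) d∣) (n∣m*n (e / suc d' ℕ.+ countMultiples (suc d') e N))
  ...   | yes _ | inj₂ ρ+1≡d = 0 , s≤s z≤n , trans (cong suc N+e≡) (trans (cong (ℕ._+ q ℕ.* suc d') ρ+1≡d)
    (solve 3 (λ d q c → d :+ (q :+ c) :* d := (q :+ (c :+ con 1)) :* d) refl (suc d') (e / suc d') (countMultiples (suc d') e N)))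
    where q = e / suc d' ℕ.+ countMultiples (suc d') e N
  ...   | no _ | inj₁ ρ+1<d = suc ρ , ρ+1<d , trans (cong suc N+e≡)
    (cong (λ c → suc ρ ℕ.+ (e / suc d' ℕ.+ c) ℕ.* suc d') (sym (ℕ.+-identityʳ (countMultiples (suc d') e N))))
  ...   | no d∤ | inj₂ ρ+1≡d = contradiction
    (subst (suc d' ∣_) (sym (trans (cong suc N+e≡) (cong (ℕ._+ q ℕ.* suc d') ρ+1≡d))) (∣m∣n⇒∣m+n ∣-refl (n∣m*n q))) d∤
    where q = e / suc d' ℕ.+ countMultiples (suc d') e N

  countMultiples-residue : ∀ d' e N → ∃ λ ρ → ρ < suc d' ×
    N ℕ.+ e % suc d' ≡ ρ ℕ.+ countMultiples (suc d') e N ℕ.* suc d'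
  countMultiples-residue d' e N with countMultiples-invariant d' e N
  ... | ρ , ρ<d , N+e≡ = ρ , ρ<d , ℕ.+-cancelʳ-≡ (q ℕ.* d) (N ℕ.+ e % d) (ρ ℕ.+ c ℕ.* d) (begin
    N ℕ.+ e % d ℕ.+ q ℕ.* d    ≡⟨ ℕ.+-assoc N (e % d) _ ⟩
    N ℕ.+ (e % d ℕ.+ q ℕ.* d)  ≡⟨ cong (N ℕ.+_) (sym (m≡m%n+[m/n]*n e d)) ⟩
    N ℕ.+ e                    ≡⟨ N+e≡ ⟩
    ρ ℕ.+ (q ℕ.+ c) ℕ.* d      ≡⟨ solve 4 (λ ρ q c d → ρ :+ (q :+ c) :* d := ρ :+ c :* d :+ q :* d) refl ρ q c d ⟩
    ρ ℕ.+ c ℕ.* d ℕ.+ q ℕ.* d  ∎)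
    where
    open ≡-Reasoning
    d = suc d'
    q = e / d
    c = countMultiples d e N

module Discrepancy where
  import Data.Nat as ℕ
  import Data.Nat.Properties as ℕ
  open import Data.Nat.Divisibility using (_∣?_)
  open import Data.Nat.DivMod using (_%_; m%n<n)
  open import Data.Rational as ℚ using (ℚ; 0ℚ; _+_; _*_; _-_; ∣_∣; _≤_)
  open import Data.Rational.Properties
  open import Data.Rational.Solver using (module +-*-Solver)
  open +-*-Solver
  open import Data.List using ([]; _∷_)
  open import Data.List.Relation.Unary.All using (_∷_)
  open RationalLemmas
  open Counting
  open CongruenceSums

  sumQ-indicatorℚ : ∀ d e N → sumQ N (λ k → indicatorℚ (d ∣? suc k ℕ.+ e)) ≡ toℚ (countMultiples d e N)
  sumQ-indicatorℚ d e zero = refl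
  sumQ-indicatorℚ d e (suc N) = trans (cong₂ _+_ (sumQ-indicatorℚ d e N) (indicatorℚ≡toℚ (d ∣? suc N ℕ.+ e)))
                                      (sym (toℚ-+ (countMultiples d e N) _))
    where
    indicatorℚ≡toℚ : {P : Set} (d : Dec P) → indicatorℚ d ≡ toℚ (indicator d)
    indicatorℚ≡toℚ (yes _) = refl
    indicatorℚ≡toℚ (no _) = refl

  -- With N + r₀ = ρ + c d (r₀ = e mod d), the discrepancy c - N/d equals (r₀ - ρ)/d, and r₀, ρ < d.
  countMultiples-discrepancy : ∀ d' e N →
    ∣ sumQ N (λ k → indicatorℚ (suc d' ∣? suc k ℕ.+ e)) - toℚ N * inv (suc d') ∣ ≤ toℚ 2
  countMultiples-discrepancy d' e N with countMultiples-residue d' e N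
  ... | ρ , ρ<d , N+r₀≡ = begin
    ∣ S - X * I ∣           ≡⟨ cong (λ s → ∣ s - X * I ∣) (sumQ-indicatorℚ (suc d') e N) ⟩
    ∣ C - X * I ∣           ≡⟨ cong ∣_∣ discrepancy≡ ⟩
    ∣ (R₀ - P) * I ∣        ≡⟨ trans (∣p*q∣≡∣p∣*∣q∣ (R₀ - P) I) (cong (∣ R₀ - P ∣ *_) (0≤p⇒∣p∣≡p I≥0)) ⟩
    ∣ R₀ - P ∣ * I          ≤⟨ *-monoʳ-≤-nonNeg I {{ℚ.nonNegative I≥0}} (∣p-q∣≤∣p∣+∣q∣ R₀ P) ⟩
    (∣ R₀ ∣ + ∣ P ∣) * I    ≡⟨ cong₂ (λ a b → (a + b) * I) (0≤p⇒∣p∣≡p (toℚ-nonNeg (e % suc d'))) (0≤p⇒∣p∣≡p (toℚ-nonNeg ρ)) ⟩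
    (R₀ + P) * I            ≤⟨ *-monoʳ-≤-nonNeg I {{ℚ.nonNegative I≥0}}
                                 (+-mono-≤ (toℚ-mono-≤ (ℕ.<⇒≤ (m%n<n e (suc d')))) (toℚ-mono-≤ (ℕ.<⇒≤ ρ<d))) ⟩
    (D + D) * I             ≡⟨ trans (*-distribʳ-+ I D D) (cong₂ _+_ (toℚ*inv d') (toℚ*inv d')) ⟩
    toℚ 2                   ∎
    where
    open ≤-Reasoning
    S = sumQ N (λ k → indicatorℚ (suc d' ∣? suc k ℕ.+ e))
    X = toℚ N
    I = inv (suc d')
    I≥0 = inv-nonNeg (suc d')
    D = toℚ (suc d')
    C = toℚ (countMultiples (suc d') e N)
    R₀ = toℚ (e % suc d')
    P = toℚ ρ
    N+r₀≡ℚ : X + R₀ ≡ P + C * D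
    N+r₀≡ℚ = trans (sym (toℚ-+ N (e % suc d'))) (trans (cong toℚ N+r₀≡)
               (trans (toℚ-+ ρ _) (cong (P +_) (toℚ-* (countMultiples (suc d') e N) (suc d')))))
    discrepancy≡ : C - X * I ≡ (R₀ - P) * I
    discrepancy≡ = begin-equality
      C - X * I                   ≡⟨ cong (λ t → t - X * I) (sym (trans (cong (C *_) (toℚ*inv d')) (*-identityʳ C))) ⟩
      C * (D * I) - X * I         ≡⟨ solve 5 (λ C D I X P → C :* (D :* I) :- X :* I := ((P :+ C :* D) :- (P :+ X)) :* I) refl C D I X P ⟩
      ((P + C * D) - (P + X)) * I ≡⟨ cong (λ t → (t - (P + X)) * I) (sym N+r₀≡ℚ) ⟩
      ((X + R₀) - (P + X)) * I    ≡⟨ solve 4 (λ X R₀ P I → ((X :+ R₀) :- (P :+ X)) :* I := (R₀ :- P) :* I) refl X R₀ P I ⟩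
      (R₀ - P) * I                ∎

  sumQ-linear : ∀ N c (f g : ℕ → ℚ) → sumQ N (λ k → c * f k + g k) ≡ c * sumQ N f + sumQ N g
  sumQ-linear zero c f g = sym (trans (+-identityʳ (c * 0ℚ)) (*-zeroʳ c))
  sumQ-linear (suc N) c f g = trans (cong (_+ (c * f N + g N)) (sumQ-linear N c f g))
    (solve 5 (λ c F G a b → (c :* F :+ G) :+ (c :* a :+ b) := c :* (F :+ a) :+ (G :+ b)) refl c (sumQ N f) (sumQ N g) (f N) (g N))

  sumQ-zero : ∀ N → sumQ N (λ _ → 0ℚ) ≡ 0ℚ
  sumQ-zero zero = refl
  sumQ-zero (suc N) = trans (+-identityʳ _) (sumQ-zero N)


  congruenceSum-discrepancy : ∀ {D} → ℕ.NonZero D → ∀ L → ModuliDivide D L → ∀ N →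
    ∣ sumQ N (λ k → eval L (suc k)) - toℚ N * mean L ∣ ≤ toℚ 2 * mass L
  congruenceSum-discrepancy D≢0 [] _ N = ≤-reflexive (begin
    ∣ sumQ N (λ _ → 0ℚ) - toℚ N * 0ℚ ∣ ≡⟨ cong₂ (λ s t → ∣ s - t ∣) (sumQ-zero N) (*-zeroʳ (toℚ N)) ⟩
    0ℚ                                ≡⟨ sym (*-zeroʳ (toℚ 2)) ⟩
    toℚ 2 * 0ℚ                        ∎)
    where open ≡-Reasoning
  congruenceSum-discrepancy D≢0 (term c zero e ∷ L) (0∣D ∷ _) N = contradiction (∣-nonZero 0∣D D≢0) λ ()
  congruenceSum-discrepancy D≢0 (term c (suc d') e ∷ L) (_ ∷ L∣D) N = begin
    ∣ sumQ N (λ k → c * ind k + eval L (suc k)) - X * (c * I + mean L) ∣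
      ≡⟨ cong (λ s → ∣ s - X * (c * I + mean L) ∣) (sumQ-linear N c ind (λ k → eval L (suc k))) ⟩
    ∣ (c * S + SL) - X * (c * I + mean L) ∣
      ≡⟨ cong ∣_∣ (solve 6 (λ c S SL X I M → (c :* S :+ SL) :- X :* (c :* I :+ M) := c :* (S :- X :* I) :+ (SL :- X :* M))
                          refl c S SL X I (mean L)) ⟩
    ∣ c * (S - X * I) + (SL - X * mean L) ∣
      ≤⟨ ∣p+q∣≤∣p∣+∣q∣ (c * (S - X * I)) (SL - X * mean L) ⟩
    ∣ c * (S - X * I) ∣ + ∣ SL - X * mean L ∣
      ≤⟨ +-mono-≤ (≤-trans (≤-reflexive (∣p*q∣≡∣p∣*∣q∣ c (S - X * I)))
                           (*-monoˡ-≤-nonNeg ∣ c ∣ {{ℚ.nonNegative (0≤∣p∣ c)}} (countMultiples-discrepancy d' e N)))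
                  (congruenceSum-discrepancy D≢0 L L∣D N) ⟩
    ∣ c ∣ * toℚ 2 + toℚ 2 * mass L
      ≡⟨ solve 3 (λ a t m → a :* t :+ t :* m := t :* (a :+ m)) refl ∣ c ∣ (toℚ 2) (mass L) ⟩
    toℚ 2 * (∣ c ∣ + mass L) ∎
    where
    open ≤-Reasoning
    ind : ℕ → ℚ
    ind k = indicatorℚ (suc d' ∣? suc k ℕ.+ e)
    X = toℚ N
    I = inv (suc d')
    S = sumQ N ind
    SL = sumQ N (λ k → eval L (suc k))

module Floor where
  import Data.Nat as ℕ
  import Data.Nat.Properties as ℕ
  open import Data.Nat.DivMod using (_%_; _/_; m≡m%n+[m/n]*n; m%n<n)
  open import Data.Nat.Coprimality using (Coprime)
  open import Data.Integer as ℤ using (+_; -[1+_])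
  import Data.Integer.Properties as ℤ
  open import Data.Rational as ℚ using (ℚ; mkℚ; 0ℚ; 1ℚ; _+_; _*_; _-_; -_; ∣_∣; _≤_; _<_; floor; *<*)
  open import Data.Rational.Properties
  open import Data.Rational.Unnormalised using (*≡*)
  import Data.Rational.Unnormalised.Properties as ℚᵘ
  open import Data.Rational.Solver using (module +-*-Solver)
  open +-*-Solver
  open RationalLemmas

  mkℚ-≡ : ∀ n d-1 .(c : Coprime n (suc d-1)) → mkℚ (+ n) d-1 c ≡ toℚ n * inv (suc d-1)
  mkℚ-≡ n d-1 c = toℚᵘ-injective (ℚᵘ.≃-sym (ℚᵘ.≃-trans (toℚᵘ-homo-* (toℚ n) (inv (suc d-1)))
    (ℚᵘ.≃-trans (ℚᵘ.*-cong (toℚᵘ-toℚ n) (toℚᵘ-inv d-1)) (*≡* (cong₂ ℤ._*_ (ℤ.*-identityʳ (+ n)) (cong +_ (sym (ℕ.+-identityʳ (suc d-1)))))))))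

  ∣floor∣≡ : ∀ n d-1 .(c : Coprime n (suc d-1)) → ℤ.∣ floor (mkℚ (+ n) d-1 c) ∣ ≡ n / suc d-1
  ∣floor∣≡ n d-1 c = trans (ℤ.abs-◃ _ _) (ℕ.+-identityʳ _)

  -- For x = n/d in lowest terms, ⌊x⌋ = q with n = r + q d, r < d, so x - ⌊x⌋ = r/d.
  ∣floor-x∣≤1 : ∀ x → 0ℚ < x → ∣ toℚ ℤ.∣ floor x ∣ - x ∣ ≤ 1ℚ
  ∣floor-x∣≤1 (mkℚ -[1+ n ] d-1 c) (*<* ())
  ∣floor-x∣≤1 (mkℚ (+ n) d-1 c) _ = begin
    ∣ toℚ ℤ.∣ floor (mkℚ (+ n) d-1 c) ∣ - mkℚ (+ n) d-1 c ∣
      ≡⟨ cong₂ (λ a b → ∣ toℚ a - b ∣) (∣floor∣≡ n d-1 c) (mkℚ-≡ n d-1 c) ⟩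
    ∣ Q - toℚ n * I ∣                   ≡⟨ cong (λ m → ∣ Q - toℚ m * I ∣) (m≡m%n+[m/n]*n n d) ⟩
    ∣ Q - toℚ (r ℕ.+ q ℕ.* d) * I ∣     ≡⟨ cong (λ t → ∣ Q - t * I ∣) (trans (toℚ-+ r (q ℕ.* d)) (cong (_+_ R) (toℚ-* q d))) ⟩
    ∣ Q - (R + Q * D) * I ∣             ≡⟨ cong ∣_∣ (solve 4 (λ Q R D I → Q :- (R :+ Q :* D) :* I := :- (R :* I) :+ Q :* (con 1ℚ :- D :* I)) refl Q R D I) ⟩
    ∣ - (R * I) + Q * (1ℚ - D * I) ∣    ≡⟨ cong (λ t → ∣ - (R * I) + Q * (1ℚ - t) ∣) (toℚ*inv d-1) ⟩
    ∣ - (R * I) + Q * (1ℚ - 1ℚ) ∣       ≡⟨ cong ∣_∣ (solve 3 (λ R I Q → :- (R :* I) :+ Q :* (con 1ℚ :- con 1ℚ) := :- (R :* I)) refl R I Q) ⟩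
    ∣ - (R * I) ∣                       ≡⟨ trans (∣-p∣≡∣p∣ (R * I)) (0≤p⇒∣p∣≡p (*-nonNeg (toℚ-nonNeg r) (inv-nonNeg d))) ⟩
    R * I                               ≤⟨ *-monoʳ-≤-nonNeg I {{ℚ.nonNegative (inv-nonNeg d)}} (toℚ-mono-≤ (ℕ.<⇒≤ (m%n<n n d))) ⟩
    D * I                               ≡⟨ toℚ*inv d-1 ⟩
    1ℚ                                  ∎
    where
    open ≤-Reasoning
    d = suc d-1
    q = n / d
    r = n % d
    Q = toℚ q
    R = toℚ r
    D = toℚ d
    I = inv d

module MeanValue where
  import Data.Nat as ℕ
  open import Data.Integer as ℤ using ()
  open import Data.Rational as ℚ using (ℚ; 0ℚ; 1ℚ; _+_; _*_; _-_; ∣_∣; _≤_; _<_; 1/_; floor)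
  open import Data.Rational.Properties
  open import Data.Rational.Solver using (module +-*-Solver)
  open +-*-Solver
  open RationalLemmas
  open CongruenceSums
  open Discrepancy using (congruenceSum-discrepancy)
  open Floor using (∣floor-x∣≤1)

  -- Σ_{n ≤ x} - x·mean splits into the discrepancy up to N = ⌊x⌋ and (N - x)·mean.
  meanValue-estimate : ∀ {D} → ℕ.NonZero D → ∀ L → ModuliDivide D L → (x : ℚ) .{{_ : ℚ.NonZero x}} → 0ℚ < x →
    ∣ (1/ x) * sumQ ℤ.∣ floor x ∣ (λ k → eval L (suc k)) - mean L ∣ ≤ toℚ 3 * ((1/ x) * mass L)
  meanValue-estimate D≢0 L L∣D x 0<x = begin
    ∣ y * S - M ∣
      ≡⟨ cong ∣_∣ split ⟩
    ∣ y * (S - X * M) + y * ((X - x) * M) ∣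
      ≤⟨ ∣p+q∣≤∣p∣+∣q∣ (y * (S - X * M)) (y * ((X - x) * M)) ⟩
    ∣ y * (S - X * M) ∣ + ∣ y * ((X - x) * M) ∣
      ≡⟨ cong₂ _+_ (∣y*∣ (S - X * M)) (trans (∣y*∣ ((X - x) * M)) (cong (y *_) (∣p*q∣≡∣p∣*∣q∣ (X - x) M))) ⟩
    y * ∣ S - X * M ∣ + y * (∣ X - x ∣ * ∣ M ∣)
      ≤⟨ +-mono-≤ (y*-mono (congruenceSum-discrepancy D≢0 L L∣D N))
                  (y*-mono (*-mono-≤-nonNeg (0≤∣p∣ (X - x)) (0≤∣p∣ M) (∣floor-x∣≤1 x 0<x) (∣mean∣≤mass L))) ⟩
    y * (toℚ 2 * E) + y * (1ℚ * E)
      ≡⟨ solve 2 (λ y E → y :* (con (toℚ 2) :* E) :+ y :* (con 1ℚ :* E) := con (toℚ 3) :* (y :* E)) refl y E ⟩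
    toℚ 3 * (y * E) ∎
    where
    open ≤-Reasoning
    y = (1/ x) {{pos⇒nonZero x {{ℚ.positive 0<x}}}}
    N = ℤ.∣ floor x ∣
    S = sumQ N (λ k → eval L (suc k))
    M = mean L
    X = toℚ N
    E = mass L
    y≥0 : 0ℚ ≤ y
    y≥0 = <⇒≤ (positive⁻¹ y {{1/pos⇒pos x {{ℚ.positive 0<x}}}})
    y*-mono : ∀ {p q} → p ≤ q → y * p ≤ y * q
    y*-mono = *-monoˡ-≤-nonNeg y {{ℚ.nonNegative y≥0}}
    ∣y*∣ : ∀ p → ∣ y * p ∣ ≡ y * ∣ p ∣
    ∣y*∣ p = trans (∣p*q∣≡∣p∣*∣q∣ y p) (cong (_* ∣ p ∣) (0≤p⇒∣p∣≡p y≥0))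
    split : y * S - M ≡ y * (S - X * M) + y * ((X - x) * M)
    split = begin-equality
      y * S - M           ≡⟨ cong (y * S -_) (sym (trans (cong (_* M) (*-inverseˡ x {{pos⇒nonZero x {{ℚ.positive 0<x}}}})) (*-identityˡ M))) ⟩
      y * S - (y * x) * M ≡⟨ solve 5 (λ y S M X x → y :* S :- (y :* x) :* M := y :* (S :- X :* M) :+ y :* ((X :- x) :* M)) refl y S M X x ⟩
      y * (S - X * M) + y * ((X - x) * M) ∎

module Expansion where
  import Data.Nat as ℕ
  open import Data.Nat.Divisibility using (_∣?_; 1∣_; ∣-refl)
  open import Data.List using ([]; _∷_)
  open import Data.List.Relation.Unary.All using ([]; _∷_)
  open import Data.Rational as ℚ using (0ℚ; 1ℚ; _+_; _*_; _-_; -_; ∣_∣; _≤_)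
  open import Data.Rational.Properties
  open import Data.Rational.Solver using (module +-*-Solver)
  open +-*-Solver
  open Unfolding
  open RationalLemmas
  open CongruenceSums
  open Radical using (radicalUpTo-nonZero; radicalUpTo-coprime-next)
  open DivisorCount using (3^ω-upTo)

  indicatorℚ-1∣ : ∀ n → indicatorℚ (1 ∣? n) ≡ 1ℚ
  indicatorℚ-1∣ n with 1 ∣? n
  ... | yes _ = refl
  ... | no 1∤n = contradiction (1∣ n) 1∤n

  localExpansion : (p α b : ℕ) → CongruenceSum
  localExpansion p α b = term u 1 0 ∷ term (A - u) p b ∷ []
    where
    u = (- inv p) ^ℚ α
    A = (1ℚ - inv p) ^ℚ α

  eval-localExpansion : ∀ p α b n → eval (localExpansion p α b) n ≡ fPrime p (n ℕ.+ b) ^ℚ α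
  eval-localExpansion p α b n rewrite indicatorℚ-1∣ (n ℕ.+ 0) with p ∣? n ℕ.+ b
  ... | yes _ = solve 2 (λ u A → u :* con 1ℚ :+ ((A :- u) :* con 1ℚ :+ con 0ℚ) := A) refl ((- inv p) ^ℚ α) ((1ℚ - inv p) ^ℚ α)
  ... | no _ = solve 2 (λ u A → u :* con 1ℚ :+ ((A :- u) :* con 0ℚ :+ con 0ℚ) := u) refl ((- inv p) ^ℚ α) ((1ℚ - inv p) ^ℚ α)

  mean-localExpansion : ∀ p α b → mean (localExpansion p α b) ≡ localFactor p α
  mean-localExpansion p α b = solve 3 (λ u A i → u :* con 1ℚ :+ ((A :- u) :* i :+ con 0ℚ) := i :* A :+ u :* (con 1ℚ :- i))
    refl ((- inv p) ^ℚ α) ((1ℚ - inv p) ^ℚ α) (inv p)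

  mass-localExpansion : ∀ p α b → mass (localExpansion p α b) ≤ toℚ 3
  mass-localExpansion p α b = begin
    ∣ u ∣ + (∣ A - u ∣ + 0ℚ)  ≡⟨ cong (∣ u ∣ +_) (+-identityʳ ∣ A - u ∣) ⟩
    ∣ u ∣ + ∣ A - u ∣         ≤⟨ +-monoʳ-≤ ∣ u ∣ (∣p-q∣≤∣p∣+∣q∣ A u) ⟩
    ∣ u ∣ + (∣ A ∣ + ∣ u ∣)   ≤⟨ +-mono-≤ ∣u∣≤1 (+-mono-≤ (∣^ℚ∣≤1 (1ℚ - inv p) α (∣1-inv∣≤1 p)) ∣u∣≤1) ⟩
    toℚ 3                     ∎
    where
    open ≤-Reasoning
    u = (- inv p) ^ℚ α
    A = (1ℚ - inv p) ^ℚ α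
    ∣u∣≤1 = ∣^ℚ∣≤1 (- inv p) α (∣-inv∣≤1 p)

  moduliDivide-localExpansion : ∀ p α b → ModuliDivide p (localExpansion p α b)
  moduliDivide-localExpansion p α b = 1∣ p ∷ ∣-refl ∷ []

  unit : CongruenceSum
  unit = term 1ℚ 1 0 ∷ []

  eval-unit : ∀ n → eval unit n ≡ 1ℚ
  eval-unit n = cong (λ i → 1ℚ * i + 0ℚ) (indicatorℚ-1∣ (n ℕ.+ 0))

  expansionUpTo : (a b : ℕ) → ℕ → CongruenceSum
  expansionUpTo a b = foldPrimeDivisors a unit (λ k L → L ⊗ localExpansion (suc k) (val (suc k) a) b)

  moduliDivide-expansionUpTo : ∀ a b k → ModuliDivide (radicalUpTo a k) (expansionUpTo a b k)
  moduliDivide-expansionUpTo a b = fold-related (primeDivisor? a) (λ R L → ModuliDivide R L) (∣-refl ∷ [])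
    λ k {R} {L} _ L∣R → moduliDivide-⊗ L (localExpansion (suc k) (val (suc k) a) b) L∣R (moduliDivide-localExpansion (suc k) (val (suc k) a) b)

  eval-expansionUpTo : ∀ a b k n →
    eval (expansionUpTo a b k) n ≡ prodQ k (primeFactor a (λ p α → fPrime p (n ℕ.+ b) ^ℚ α))
  eval-expansionUpTo a b zero n = eval-unit n
  eval-expansionUpTo a b (suc k) n with primeDivisor? a k
  ... | yes (k+1-prime , _) = trans
    (eval-⊗ (radicalUpTo-nonZero a k) _ (radicalUpTo-coprime-next a k k+1-prime) (expansionUpTo a b k) (localExpansion (suc k) α b)
            (moduliDivide-expansionUpTo a b k) (moduliDivide-localExpansion (suc k) α b) n)
    (cong₂ _*_ (eval-expansionUpTo a b k n) (eval-localExpansion (suc k) α b n))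
    where α = val (suc k) a
  ... | no _ = trans (eval-expansionUpTo a b k n) (sym (*-identityʳ _))

  mean-expansionUpTo : ∀ a b k → mean (expansionUpTo a b k) ≡ prodQ k (primeFactor a localFactor)
  mean-expansionUpTo a b zero = refl
  mean-expansionUpTo a b (suc k) with primeDivisor? a k
  ... | yes _ = trans (mean-⊗ (expansionUpTo a b k) (localExpansion (suc k) (val (suc k) a) b))
                      (cong₂ _*_ (mean-expansionUpTo a b k) (mean-localExpansion (suc k) (val (suc k) a) b))
  ... | no _ = trans (mean-expansionUpTo a b k) (sym (*-identityʳ _))

  mass-expansionUpTo : ∀ a b k → mass (expansionUpTo a b k) ≤ toℚ (3^ω-upTo a k)
  mass-expansionUpTo a b = fold-related (primeDivisor? a) (λ L w → mass L ≤ toℚ w) ≤-refl step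
    where
    step : ∀ k {L w} → PrimeDivisor a k → mass L ≤ toℚ w →
           mass (L ⊗ localExpansion (suc k) (val (suc k) a) b) ≤ toℚ (3 ℕ.* w)
    step k {L} {w} _ mass-L≤w = begin
      mass (L ⊗ φ)      ≡⟨ mass-⊗ L φ ⟩
      mass L * mass φ   ≤⟨ *-mono-≤-nonNeg (mass-nonNeg L) (mass-nonNeg φ) mass-L≤w (mass-localExpansion (suc k) (val (suc k) a) b) ⟩
      toℚ w * toℚ 3     ≡⟨ trans (*-comm (toℚ w) (toℚ 3)) (sym (toℚ-* 3 w)) ⟩
      toℚ (3 ℕ.* w)     ∎
      where
      open ≤-Reasoning
      φ = localExpansion (suc k) (val (suc k) a) b

module ProductExpansion where
  import Data.Nat as ℕ
  import Data.Nat.Properties as ℕ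
  open import Data.Nat.Coprimality as Coprime using (Coprime)
  open import Data.Nat.Divisibility using (∣1⇒≡1; ∣-refl)
  open import Data.List using ([]; _∷_)
  open import Data.List.Relation.Unary.All using ([]; _∷_)
  open import Data.Fin as Fin using (Fin)
  import Data.Fin.Properties as Fin
  open import Data.Rational as ℚ using (ℚ; 0ℚ; 1ℚ; _*_; _≤_)
  open import Data.Rational.Properties
  open import Relation.Binary.PropositionalEquality using (_≢_)
  open import Function using (_∘_)
  open Unfolding
  open CoprimeLemmas using (coprime-*ˡ)
  open Radical using (radicalUpTo-nonZero; radicalUpTo-coprime)
  open DivisorCount using (3^ω-upTo; 3^ω-upTo-≤; divisorCount)
  open RationalLemmas
  open CongruenceSums
  open Expansion

  Pairwise-coprime : (r : ℕ) → (Fin r → ℕ) → Set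
  Pairwise-coprime r a = ∀ i j → i ≢ j → Coprime (a i) (a j)

  expansion : (r : ℕ) → (a b : Fin r → ℕ) → CongruenceSum
  expansion zero a b = unit
  expansion (suc r) a b = expansionUpTo (a Fin.zero) (b Fin.zero) (a Fin.zero) ⊗ expansion r (λ i → a (Fin.suc i)) (λ i → b (Fin.suc i))

  radicalProduct : (r : ℕ) → (Fin r → ℕ) → ℕ
  radicalProduct zero a = 1
  radicalProduct (suc r) a = radicalUpTo (a Fin.zero) (a Fin.zero) ℕ.* radicalProduct r (λ i → a (Fin.suc i))

  radicalProduct-nonZero : ∀ r a → ℕ.NonZero (radicalProduct r a)
  radicalProduct-nonZero zero a = _
  radicalProduct-nonZero (suc r) a =
    ℕ.m*n≢0 _ _ {{radicalUpTo-nonZero (a Fin.zero) (a Fin.zero)}} {{radicalProduct-nonZero r (λ i → a (Fin.suc i))}}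

  radicalProduct-coprime : ∀ r a {x} → (∀ i → Coprime (a i) x) → Coprime (radicalProduct r a) x
  radicalProduct-coprime zero a _ (i∣1 , _) = ∣1⇒≡1 i∣1
  radicalProduct-coprime (suc r) a a⊥x =
    coprime-*ˡ (radicalUpTo-coprime (a Fin.zero) (a Fin.zero) (a⊥x Fin.zero)) (radicalProduct-coprime r (λ i → a (Fin.suc i)) (λ i → a⊥x (Fin.suc i)))

  moduliDivide-expansion : ∀ r a b → ModuliDivide (radicalProduct r a) (expansion r a b)
  moduliDivide-expansion zero a b = ∣-refl ∷ []
  moduliDivide-expansion (suc r) a b =
    moduliDivide-⊗ (expansionUpTo (a Fin.zero) (b Fin.zero) (a Fin.zero)) (expansion r (λ i → a (Fin.suc i)) (λ i → b (Fin.suc i)))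
      (moduliDivide-expansionUpTo (a Fin.zero) (b Fin.zero) (a Fin.zero)) (moduliDivide-expansion r (λ i → a (Fin.suc i)) (λ i → b (Fin.suc i)))

  prodFin-cong : ∀ r {g h : Fin r → ℚ} → (∀ i → g i ≡ h i) → prodFin r g ≡ prodFin r h
  prodFin-cong zero g≗h = refl
  prodFin-cong (suc r) g≗h = cong₂ _*_ (g≗h Fin.zero) (prodFin-cong r (λ i → g≗h (Fin.suc i)))

  prodFin-nonNeg : ∀ r {g : Fin r → ℚ} → (∀ i → 0ℚ ≤ g i) → 0ℚ ≤ prodFin r g
  prodFin-nonNeg zero _ = nonNegative⁻¹ 1ℚ
  prodFin-nonNeg (suc r) g≥0 = *-nonNeg (g≥0 Fin.zero) (prodFin-nonNeg r (λ i → g≥0 (Fin.suc i)))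

  prodFin-mono-≤ : ∀ r {g h : Fin r → ℚ} → (∀ i → 0ℚ ≤ g i) → (∀ i → g i ≤ h i) → prodFin r g ≤ prodFin r h
  prodFin-mono-≤ zero _ _ = ≤-refl
  prodFin-mono-≤ (suc r) g≥0 g≤h = *-mono-≤-nonNeg (g≥0 Fin.zero) (prodFin-nonNeg r (λ i → g≥0 (Fin.suc i)))
    (g≤h Fin.zero) (prodFin-mono-≤ r (λ i → g≥0 (Fin.suc i)) (λ i → g≤h (Fin.suc i)))

  eval-expansion : ∀ r a b → Pairwise-coprime r a → ∀ n →
    eval (expansion r a b) n ≡ prodFin r (λ i → prodQ (a i) (primeFactor (a i) (λ p α → fPrime p (n ℕ.+ b i) ^ℚ α)))
  eval-expansion zero a b _ n = eval-unit n
  eval-expansion (suc r) a b a-coprime n = trans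
    (eval-⊗ (radicalUpTo-nonZero a₀ a₀) (radicalProduct-nonZero r a') rad₀⊥rad'
       (expansionUpTo a₀ (b Fin.zero) a₀) (expansion r a' b')
       (moduliDivide-expansionUpTo a₀ (b Fin.zero) a₀) (moduliDivide-expansion r a' b') n)
    (cong₂ _*_ (eval-expansionUpTo a₀ (b Fin.zero) a₀ n)
               (eval-expansion r a' b' (λ i j i≢j → a-coprime (Fin.suc i) (Fin.suc j) (i≢j ∘ Fin.suc-injective)) n))
    where
    a₀ = a Fin.zero
    a' b' : Fin r → ℕ
    a' i = a (Fin.suc i)
    b' i = b (Fin.suc i)
    rad₀⊥rad' : Coprime (radicalUpTo a₀ a₀) (radicalProduct r a')
    rad₀⊥rad' = Coprime.sym (radicalProduct-coprime r a' λ i →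
      Coprime.sym (radicalUpTo-coprime a₀ a₀ (a-coprime Fin.zero (Fin.suc i) λ ())))

  mean-expansion : ∀ r a b → mean (expansion r a b) ≡ prodFin r (λ i → prodQ (a i) (primeFactor (a i) localFactor))
  mean-expansion zero a b = refl
  mean-expansion (suc r) a b = trans
    (mean-⊗ (expansionUpTo (a Fin.zero) (b Fin.zero) (a Fin.zero)) (expansion r (λ i → a (Fin.suc i)) (λ i → b (Fin.suc i))))
    (cong₂ _*_ (mean-expansionUpTo (a Fin.zero) (b Fin.zero) (a Fin.zero)) (mean-expansion r (λ i → a (Fin.suc i)) (λ i → b (Fin.suc i))))

  mass-expansion : ∀ r a b → mass (expansion r a b) ≤ prodFin r (λ i → toℚ (3^ω-upTo (a i) (a i)))
  mass-expansion zero a b = ≤-refl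
  mass-expansion (suc r) a b = begin
    mass (L₀ ⊗ L')        ≡⟨ mass-⊗ L₀ L' ⟩
    mass L₀ * mass L'     ≤⟨ *-mono-≤-nonNeg (mass-nonNeg L₀) (mass-nonNeg L')
                              (mass-expansionUpTo (a Fin.zero) (b Fin.zero) (a Fin.zero)) (mass-expansion r (λ i → a (Fin.suc i)) (λ i → b (Fin.suc i))) ⟩
    prodFin (suc r) (λ i → toℚ (3^ω-upTo (a i) (a i))) ∎
    where
    open ≤-Reasoning
    L₀ = expansionUpTo (a Fin.zero) (b Fin.zero) (a Fin.zero)
    L' = expansion r (λ i → a (Fin.suc i)) (λ i → b (Fin.suc i))

  prodFin-f≡eval-expansion : ∀ r a b → Pairwise-coprime r a → ∀ n →
    prodFin r (λ i → f (a i) (n ℕ.+ b i)) ≡ eval (expansion r a b) n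
  prodFin-f≡eval-expansion r a b a-coprime n =
    trans (prodFin-cong r (λ i → primeProd-≡ (a i) _)) (sym (eval-expansion r a b a-coprime n))

  prodFin-mainFactor≡mean-expansion : ∀ r a b → prodFin r (λ i → mainFactor (a i)) ≡ mean (expansion r a b)
  prodFin-mainFactor≡mean-expansion r a b =
    trans (prodFin-cong r (λ i → primeProd-≡ (a i) localFactor)) (sym (mean-expansion r a b))

  mass-expansion-≤-τ² : ∀ r a b → mass (expansion r a b) ≤ prodFin r (λ i → toℚ (τ (radical (a i)) ℕ.* τ (radical (a i))))
  mass-expansion-≤-τ² r a b = ≤-trans (mass-expansion r a b) (prodFin-mono-≤ r (λ i → toℚ-nonNeg (3^ω-upTo (a i) (a i))) λ i →
    toℚ-mono-≤ (ℕ.≤-trans (3^ω-upTo-≤ (a i) (a i)) (ℕ.≤-reflexive (sym (cong (λ t → t ℕ.* t) (τ-rad≡ (a i)))))))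
    where
    τ-rad≡ : ∀ m → τ (radical m) ≡ divisorCount (radicalUpTo m m)
    τ-rad≡ m = trans (cong τ (radical-≡ m)) (τ-≡ (radicalUpTo m m))

open import Data.Nat as ℕ using (_≥_)
open import Data.Nat.Coprimality using (Coprime)
open import Data.Integer as ℤ using (ℤ)
open import Data.Rational as ℚ using (_+_; _*_; _-_; ∣_∣; floor; 1/_; NonZero; _≤_; _<_)
open import Data.Rational.Properties using (*-monoˡ-≤-nonNeg; 1/pos⇒pos; pos⇒nonNeg; pos⇒nonZero; module ≤-Reasoning)
open import Data.Fin using (Fin)
open import Data.Product using (∃)
open import Relation.Binary.PropositionalEquality using (_≢_)
open RationalLemmas using (toℚ-nonNeg)
open MeanValue using (meanValue-estimate)
open ProductExpansion
open CongruenceSums using (eval; mean; mass)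

sumQ-cong : ∀ N {g h : ℕ → ℚ} → (∀ k → g k ≡ h k) → sumQ N g ≡ sumQ N h
sumQ-cong zero g≗h = refl
sumQ-cong (suc N) g≗h = cong₂ _+_ (sumQ-cong N g≗h) (g≗h N)

correlation-estimate : ∀ r (a b : Fin r → ℕ) → Pairwise-coprime r a → (x : ℚ) → .{{_ : NonZero x}} → 0ℚ < x →
  ∣ (1/ x) * sumQ ℤ.∣ floor x ∣ (λ k → prodFin r (λ i → f (a i) (suc k ℕ.+ b i))) - prodFin r (λ i → mainFactor (a i)) ∣
    ≤ toℚ 3 * ((1/ x) * prodFin r (λ i → toℚ (τ (radical (a i)) ℕ.* τ (radical (a i)))))
correlation-estimate r a b a-coprime x 0<x = begin
  ∣ 1/x * sumQ N (λ k → prodFin r (λ i → f (a i) (suc k ℕ.+ b i))) - prodFin r (λ i → mainFactor (a i)) ∣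
    ≡⟨ cong₂ (λ s m → ∣ 1/x * s - m ∣) (sumQ-cong N (λ k → prodFin-f≡eval-expansion r a b a-coprime (suc k)))
                                          (prodFin-mainFactor≡mean-expansion r a b) ⟩
  ∣ 1/x * sumQ N (λ k → eval L (suc k)) - mean L ∣
    ≤⟨ meanValue-estimate (radicalProduct-nonZero r a) L (moduliDivide-expansion r a b) x {{x≢0}} 0<x ⟩
  toℚ 3 * (1/x * mass L)
    ≤⟨ *-monoˡ-≤-nonNeg (toℚ 3) {{ℚ.nonNegative (toℚ-nonNeg 3)}} (*-monoˡ-≤-nonNeg 1/x {{1/x≥0}} (mass-expansion-≤-τ² r a b)) ⟩
  toℚ 3 * (1/x * prodFin r (λ i → toℚ (τ (radical (a i)) ℕ.* τ (radical (a i))))) ∎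
  where
  open ≤-Reasoning
  N = ℤ.∣ floor x ∣
  L = expansion r a b
  x≢0 : NonZero x
  x≢0 = pos⇒nonZero x {{ℚ.positive 0<x}}
  1/x = (1/ x) {{x≢0}}
  1/x≥0 : ℚ.NonNegative 1/x
  1/x≥0 = pos⇒nonNeg 1/x {{1/pos⇒pos x {{ℚ.positive 0<x}}}}

lemma3 : (r : ℕ) → r ≥ 1 →
  ∃ λ (C : ℚ) →
    (a b : Fin r → ℕ) →
    (∀ i → a i ≥ 1) →
    (∀ i j → i ≢ j → Coprime (a i) (a j)) →
    (x : ℚ) → .{{_ : NonZero x}} → 0ℚ < x →
    ∣ (1/ x) * sumQ ℤ.∣ floor x ∣ (λ k → prodFin r (λ i → f (a i) (suc k ℕ.+ b i)))
      - prodFin r (λ i → mainFactor (a i)) ∣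
      ≤ C * ((1/ x) * prodFin r (λ i → toℚ (τ (radical (a i)) ℕ.* τ (radical (a i)))))
lemma3 r _ = toℚ 3 , λ a b _ → correlation-estimate r a b
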